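{- Let $m$ be a positive integer. Fagan's construction starting from the pair $(2,2m)$ terminates, its final pair $(i,y)$ satisfies $i = y$, and this common value $\mathsf{cf}(m)$ equals $\mathsf{sr}(2m)$.
   Context: Fagan's construction: for a positive integer $m$, the first Fagan pair is $(2,2m)$. If the current Fagan pair is $(i,y)$ with $y>i$, the next Fagan pair is $(i+1,z)$ where $z$ is the smallest integer such that $(i+1)z > iy$ and $i+1+z$ is even. The construction stops when the current pair $(i,y)$ satisfies $y \leq i$. For $n \in \{1,2,\ldots\}$, $\mathsf{Alist}_n$ is the sequence of integer pairs produced as follows: begin with $\langle 1, n\rangle$. Given the current pair $\langle i, y_i\rangle$ with $y_i > i$, the next pair is $\langle i+1, y_{i+1}\rangle$, where $y_{i+1}$ is the smallest integer with $(i+1)y_{i+1} > i(y_i+1)$. Stop when the current pair $\langle i,y_i\rangle$ satisfies $y_i \leq i$. This process always terminates; its final pair is denoted $\langle \mathsf{sr}(n), y_{\mathsf{sr}(n)}\rangle$, and $\mathsf{sr}(n)$ is called the strange root of $n$. -}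

module Defs where

open import Data.Nat using (ℕ; suc; _+_; _*_; _≤_; _<_)
open import Data.Nat.Divisibility using (_∣_)
open import Data.Product using (_×_)

-- Fagan step: from the pair (i , y), z is the smallest integer with
-- (i+1) z > i y and i+1+z even.  (Any such integer is positive since
-- i y ≥ 0, so minimising over ℕ is the same as over ℤ.)
FaganNext : ℕ → ℕ → ℕ → Set
FaganNext i y z =
  (i * y < suc i * z) × (2 ∣ (suc i + z)) ×
  (∀ w → i * y < suc i * w → 2 ∣ (suc i + w) → z ≤ w)

data FaganRun : ℕ → ℕ → ℕ → ℕ → Set where
  stop : ∀ {i y} → y ≤ i → FaganRun i y i y
  step : ∀ {i y z i' y'} → i < y → FaganNext i y z →
         FaganRun (suc i) z i' y' → FaganRun i y i' y'

AlistNext : ℕ → ℕ → ℕ → Set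
AlistNext i y z =
  (i * (y + 1) < suc i * z) ×
  (∀ w → i * (y + 1) < suc i * w → z ≤ w)

-- AlistRun i y i' y' : the Alist process started at ⟨ i , y ⟩ terminates
-- with final pair ⟨ i' , y' ⟩.  Alist_n is the run from ⟨ 1 , n ⟩, and
-- sr(n) is the first component of its final pair.
data AlistRun : ℕ → ℕ → ℕ → ℕ → Set where
  stop : ∀ {i y} → y ≤ i → AlistRun i y i y
  step : ∀ {i y z i' y'} → i < y → AlistNext i y z →
         AlistRun (suc i) z i' y' → AlistRun i y i' y'

StrangeRoot : ℕ → ℕ → Set
StrangeRoot n s = Data.Product.Σ ℕ (λ y → AlistRun 1 n s y)

{-# OPTIONS --safe #-}
-- Write the Fagan value at index i as f = 2w − i.  Then (i+1) z > i f with
-- z = 2w' − (i+1) is equivalent to (i+1) w' > i (w+1) (double both sides), and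
-- the parity condition on i+1+z says precisely that z has this shape.  So
-- Fagan's construction from (2, 2m) runs in lockstep with Alist_{2m} from its
-- second pair ⟨2, m+1⟩; the Alist run keeps i ≤ w and so stops at w = i,
-- where the Fagan value 2w − i equals i as well.
module Submission where

open import Defs
open import Data.Nat using (ℕ; suc; zero; _*_; _+_; _∸_; _≤_; _<_; _≤?_; z≤n; s≤s)
open import Data.Nat.Properties
open import Data.Nat.DivMod using (_/_; _%_; m≡m%n+[m/n]*n; m%n<n)
open import Data.Nat.Divisibility using (_∣_; divides)
open import Data.Product using (Σ; _×_; _,_; proj₁; proj₂)
open import Relation.Binary.PropositionalEquality
open import Relation.Nullary using (yes; no)
open import Data.Empty using (⊥-elim)
open import Data.Nat.Solver using (module +-*-Solver)
open +-*-Solver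

least-multiplier-exceeding : ∀ n d →
  Σ ℕ (λ q → n < suc d * q × (∀ v → n < suc d * v → q ≤ v))
least-multiplier-exceeding n d = suc q , n<[1+d]*[1+q] , least
  where
  q = n / suc d
  r = n % suc d
  n≡r+q*[1+d] : n ≡ r + q * suc d
  n≡r+q*[1+d] = m≡m%n+[m/n]*n n (suc d)
  n<[1+d]*[1+q] : n < suc d * suc q
  n<[1+d]*[1+q] = begin-strict
      n                  ≡⟨ n≡r+q*[1+d] ⟩
      r + q * suc d      <⟨ +-monoˡ-< (q * suc d) (m%n<n n (suc d)) ⟩
      suc d + q * suc d  ≡⟨ cong (suc d +_) (*-comm q (suc d)) ⟩
      suc d + suc d * q  ≡⟨ sym (*-suc (suc d) q) ⟩
      suc d * suc q      ∎
    where open ≤-Reasoning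
  least : ∀ v → n < suc d * v → suc q ≤ v
  least v n<[1+d]*v = *-cancelʳ-< (suc d) q v (begin-strict
      q * suc d      ≤⟨ m≤n+m (q * suc d) r ⟩
      r + q * suc d  ≡⟨ sym n≡r+q*[1+d] ⟩
      n              <⟨ n<[1+d]*v ⟩
      suc d * v      ≡⟨ *-comm (suc d) v ⟩
      v * suc d      ∎)
    where open ≤-Reasoning

alistNext-exists : ∀ i y → Σ ℕ (AlistNext i y)
alistNext-exists i y = least-multiplier-exceeding (i * (y + 1)) i

module _ {i y z : ℕ} (i<y : i < y) (next : AlistNext i y z) where

  alistNext-≤ : z ≤ y
  alistNext-≤ = proj₂ next y (begin-strict
      i * (y + 1)    ≡⟨ *-distribˡ-+ i y 1 ⟩
      i * y + i * 1  ≡⟨ cong (i * y +_) (*-identityʳ i) ⟩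
      i * y + i      <⟨ +-monoʳ-< (i * y) i<y ⟩
      i * y + y      ≡⟨ +-comm (i * y) y ⟩
      suc i * y      ∎)
    where open ≤-Reasoning

  alistNext-> : i < z
  alistNext-> = *-cancelˡ-< (suc i) i z (begin-strict
      suc i * i    ≡⟨ *-comm (suc i) i ⟩
      i * suc i    ≤⟨ *-monoʳ-≤ i (≤-trans i<y (m≤m+n y 1)) ⟩
      i * (y + 1)  <⟨ proj₁ next ⟩
      suc i * z    ∎)
    where open ≤-Reasoning

alistRun-diagonal : ∀ i y → i ≤ y → Σ ℕ (λ c → AlistRun i y c c)
alistRun-diagonal i y i≤y = run (y ∸ i) i y i≤y (m≤n+m∸n y i)
  where
  run : ∀ k i y → i ≤ y → y ≤ i + k → Σ ℕ (λ c → AlistRun i y c c)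
  run k i y i≤y y≤i+k with y ≤? i
  ... | yes y≤i rewrite ≤-antisym y≤i i≤y = i , stop ≤-refl
  run zero i y i≤y y≤i+0 | no y≰i = ⊥-elim (y≰i (subst (y ≤_) (+-identityʳ i) y≤i+0))
  run (suc k) i y i≤y y≤i+k+1 | no y≰i = extend (≰⇒> y≰i)
    where
    extend : i < y → Σ ℕ (λ c → AlistRun i y c c)
    extend i<y with z , next ← alistNext-exists i y
      with c , rest ← run k (suc i) z (alistNext-> i<y next)
                        (≤-trans (alistNext-≤ i<y next) (subst (y ≤_) (+-suc i k) y≤i+k+1))
      = c , step i<y next rest

-- f = 2w − i, stated without truncated subtraction.
record Paired (i f w : ℕ) : Set where
  constructor paired
  field sum≡double : f + i ≡ w + w

paired-*-double : ∀ {j g u} → Paired j g u → j * g + j * j ≡ 2 * (j * u)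
paired-*-double {j} {g} {u} (paired g+j≡u+u) = begin
    j * g + j * j  ≡⟨ sym (*-distribˡ-+ j g j) ⟩
    j * (g + j)    ≡⟨ cong (j *_) g+j≡u+u ⟩
    j * (u + u)    ≡⟨ solve 2 (λ j u → j :* (u :+ u) := con 2 :* (j :* u)) refl j u ⟩
    2 * (j * u)    ∎
  where open ≡-Reasoning

paired-alist-double : ∀ {i f w} → Paired i f w →
  suc (i * f) + suc i * suc i ≡ 2 * suc (i * (w + 1))
paired-alist-double {i} {f} {w} f~w = begin
    suc (i * f) + suc i * suc i
      ≡⟨ solve 2 (λ i f → con 1 :+ i :* f :+ (con 1 :+ i) :* (con 1 :+ i)
                         := (i :* f :+ i :* i) :+ (con 2 :+ con 2 :* i)) refl i f ⟩
    (i * f + i * i) + (2 + 2 * i)  ≡⟨ cong (_+ (2 + 2 * i)) (paired-*-double f~w) ⟩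
    2 * (i * w) + (2 + 2 * i)
      ≡⟨ solve 2 (λ i w → con 2 :* (i :* w) :+ (con 2 :+ con 2 :* i)
                         := con 2 :* (con 1 :+ i :* (w :+ con 1))) refl i w ⟩
    2 * suc (i * (w + 1))  ∎
  where open ≡-Reasoning

module _ {i f w z u : ℕ} (f~w : Paired i f w) (z~u : Paired (suc i) z u) where

  alist<⇒fagan< : i * (w + 1) < suc i * u → i * f < suc i * z
  alist<⇒fagan< lt = +-cancelʳ-≤ (suc i * suc i) (suc (i * f)) (suc i * z)
    (subst₂ _≤_ (sym (paired-alist-double f~w)) (sym (paired-*-double z~u))
      (*-monoʳ-≤ 2 lt))

  fagan<⇒alist< : i * f < suc i * z → i * (w + 1) < suc i * u
  fagan<⇒alist< lt = *-cancelˡ-≤ 2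
    (subst₂ _≤_ (paired-alist-double f~w) (paired-*-double z~u)
      (+-monoˡ-≤ (suc i * suc i) lt))

paired-exists : ∀ {i u} → i ≤ u → Σ ℕ (λ z → Paired i z u)
paired-exists {i} {u} i≤u = u + u ∸ i , paired (m∸n+n≡m (≤-trans i≤u (m≤m+n u u)))

paired-> : ∀ {i f w} → Paired i f w → i < w → i < f
paired-> {i} {f} {w} (paired f+i≡w+w) i<w =
  +-cancelʳ-< i i f (subst (i + i <_) (sym f+i≡w+w) (+-mono-< i<w i<w))

paired-self : ∀ {i f} → Paired i f i → f ≡ i
paired-self {i} {f} (paired f+i≡i+i) = +-cancelʳ-≡ i f i f+i≡i+i

2∣⇒paired : ∀ {i v} → 2 ∣ (i + v) → Σ ℕ (λ t → Paired i v t)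
2∣⇒paired {i} {v} (divides t i+v≡t*2) =
  t , paired (trans (+-comm v i) (trans i+v≡t*2 (solve 1 (λ t → t :* con 2 := t :+ t) refl t)))

faganNext-of-alistNext : ∀ {i f w z u} → Paired i f w → Paired (suc i) z u →
  AlistNext i w u → FaganNext i f z
faganNext-of-alistNext {i} {f} {w} {z} {u} f~w z~u@(paired z+i+1≡u+u) (above , least) =
  alist<⇒fagan< f~w z~u above , even , fagan-least
  where
  even : 2 ∣ (suc i + z)
  even = divides u (trans (+-comm (suc i) z)
           (trans z+i+1≡u+u (solve 1 (λ u → u :+ u := u :* con 2) refl u)))
  fagan-least : ∀ v → i * f < suc i * v → 2 ∣ (suc i + v) → z ≤ v
  fagan-least v v-above v-even with t , v~t ← 2∣⇒paired v-even =
    +-cancelʳ-≤ (suc i) z v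
      (subst₂ _≤_ (sym z+i+1≡u+u) (sym (Paired.sum≡double v~t)) (+-mono-≤ u≤t u≤t))
    where
    u≤t : u ≤ t
    u≤t = least t (fagan<⇒alist< f~w v~t v-above)

faganRun-of-alistRun : ∀ {i w f c} → AlistRun i w c c → Paired i f w → FaganRun i f c c
faganRun-of-alistRun (stop _) f~c with refl ← paired-self f~c = stop ≤-refl
faganRun-of-alistRun (step i<w next rest) f~w
  with z , z~u ← paired-exists (alistNext-> i<w next) =
  step (paired-> f~w i<w) (faganNext-of-alistNext f~w z~u next)
       (faganRun-of-alistRun rest z~u)

module _ (m : ℕ) where

  alistNext-start : AlistNext 1 (2 * suc m) (suc (suc m))
  alistNext-start =
    subst (_≤ 2 * suc (suc m)) (sym 1+1*[n+1]≡2*[m+2]) ≤-refl ,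
    λ v h → *-cancelˡ-≤ 2 (subst (_≤ 2 * v) 1+1*[n+1]≡2*[m+2] h)
    where
    1+1*[n+1]≡2*[m+2] : suc (1 * (2 * suc m + 1)) ≡ 2 * suc (suc m)
    1+1*[n+1]≡2*[m+2] = solve 1 (λ m → con 1 :+ con 1 :* (con 2 :* (con 1 :+ m) :+ con 1)
                         := con 2 :* (con 2 :+ m)) refl m

  paired-start : Paired 2 (2 * suc m) (suc (suc m))
  paired-start = paired (solve 1 (λ m → con 2 :* (con 1 :+ m) :+ con 2
                             := (con 2 :+ m) :+ (con 2 :+ m)) refl m)

mainTheorem2 : (m : ℕ) → Σ ℕ (λ c → FaganRun 2 (2 * suc m) c c × StrangeRoot (2 * suc m) c)
mainTheorem2 m with c , run ← alistRun-diagonal 2 (suc (suc m)) (s≤s (s≤s z≤n)) =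
  c , faganRun-of-alistRun run (paired-start m) ,
  (c , step (*-monoʳ-≤ 2 (s≤s z≤n)) (alistNext-start m) run)
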